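{- For all $n\ge4$, the number of convex polyominoes $\nu$ (up to translation) with $d_2(\nu)+d_3(\nu)=n$ equals the number of convex polyominoes $\nu$ (up to translation) with $d_3(\nu)+d_4(\nu)=n-4$.
   Context: A cell is a unit square in the plane with sides parallel to the axes and center at an integer point. A polyomino is a finite edge-connected set of cells, considered up to translation; it is convex if each of its columns (cells with a common center $x$-coordinate) and each of its rows (cells with a common center $y$-coordinate) is a contiguous block. The degree of a vertex (corner point of a cell) of $\nu$ is the number of distinct unit edges of cells of $\nu$ incident to it. A vertex of a cell of $\nu$ is interior if it is a vertex of four distinct cells of $\nu$, and a boundary vertex otherwise; $d_m(\nu)$ is the number of boundary vertices of $\nu$ of degree $m$ ($m\in\{2,3,4\}$). -}

module Defs where

open import Data.Bool using (Bool; true; false; _∧_; _∨_; not; if_then_else_)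
open import Data.Nat as ℕ using (ℕ; zero; suc; _≡ᵇ_)
open import Data.Nat.Properties using (_<?_)
open import Data.Integer as ℤ using (ℤ; +_; -[1+_]; _≤_)
open import Data.Fin using (Fin; fromℕ<)
open import Data.Vec using (Vec; lookup)
open import Data.List using (List; upTo; map; concatMap)
open import Data.Nat.ListAction using (sum)
open import Data.Product using (_×_; _,_; ∃)
open import Relation.Nullary using (yes; no)
open import Relation.Binary.PropositionalEquality using (_≡_)

-- Cells.  The cell with centre (x , y) ∈ ℤ² is the unit square
-- [x - 1/2, x + 1/2] × [y - 1/2, y + 1/2].

Cell : Set
Cell = ℤ × ℤ

Adj : Cell → Cell → Set
Adj (x₁ , y₁) (x₂ , y₂) = ℤ.∣ x₁ ℤ.- x₂ ∣ ℕ.+ ℤ.∣ y₁ ℤ.- y₂ ∣ ≡ 1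

-- A finite set of cells inside the box [0,w) × [0,h), stored as a
-- grid of booleans (row y, column x).

Grid : ℕ → ℕ → Set
Grid w h = Vec (Vec Bool w) h

cellAt : ∀ {w h} → Grid w h → ℤ → ℤ → Bool
cellAt {w} {h} g (+ x) (+ y) with x <? w | y <? h
... | yes x<w | yes y<h = lookup (lookup g (fromℕ< y<h)) (fromℕ< x<w)
... | _       | _       = false
cellAt g _ _ = false

_∈G_ : ∀ {w h} → Cell → Grid w h → Set
(x , y) ∈G g = cellAt g x y ≡ true

data Path {w h} (g : Grid w h) : Cell → Cell → Set where
  here : ∀ {a} → a ∈G g → Path g a a
  step : ∀ {a b c} → a ∈G g → Adj a b → Path g b c → Path g a c

Connected : ∀ {w h} → Grid w h → Set
Connected g = ∀ a b → a ∈G g → b ∈G g → Path g a b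

RowConvex : ∀ {w h} → Grid w h → Set
RowConvex g = ∀ x₁ x x₂ y → (x₁ , y) ∈G g → (x₂ , y) ∈G g →
  x₁ ≤ x → x ≤ x₂ → (x , y) ∈G g

ColConvex : ∀ {w h} → Grid w h → Set
ColConvex g = ∀ x y₁ y y₂ → (x , y₁) ∈G g → (x , y₂) ∈G g →
  y₁ ≤ y → y ≤ y₂ → (x , y) ∈G g

-- Each translation class has a
-- unique representative whose bounding box is exactly [0,w) × [0,h):
-- the set meets column 0, row 0, column w-1 and row h-1 (this also
-- forces the set to be nonempty).  The property fields are irrelevant,
-- so two such records are equal iff they are the same set of cells.

record ConvexPolyomino : Set where
  field
    w h  : ℕ
    grid : Grid w h
    .touchLeft   : ∃ λ y → (+ 0 , y) ∈G grid
    .touchBottom : ∃ λ x → (x , + 0) ∈G grid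
    .touchRight  : ∃ λ y → (+ w ℤ.- ℤ.1ℤ , y) ∈G grid
    .touchTop    : ∃ λ x → (x , + h ℤ.- ℤ.1ℤ) ∈G grid
    .connected   : Connected grid
    .rowConvex   : RowConvex grid
    .colConvex   : ColConvex grid

-- Vertices.  The lattice point (i , j) stands for the corner point
-- (i - 1/2 , j - 1/2); the four cells having it as a vertex are
-- NE = (i , j), NW = (i-1 , j), SE = (i , j-1), SW = (i-1 , j-1).

module _ {w h} (g : Grid w h) (i j : ℤ) where
  private
    NE NW SE SW : Bool
    NE = cellAt g i j
    NW = cellAt g (i ℤ.- ℤ.1ℤ) j
    SE = cellAt g i (j ℤ.- ℤ.1ℤ)
    SW = cellAt g (i ℤ.- ℤ.1ℤ) (j ℤ.- ℤ.1ℤ)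

    b2n : Bool → ℕ
    b2n true  = 1
    b2n false = 0

  isVertex : Bool
  isVertex = NE ∨ NW ∨ SE ∨ SW

  isInterior : Bool
  isInterior = NE ∧ NW ∧ SE ∧ SW

  isBoundary : Bool
  isBoundary = isVertex ∧ not isInterior

  -- number of distinct unit edges of cells of the set incident to it:
  -- right edge (of NE/SE), left edge (of NW/SW), up edge (of NW/NE),
  -- down edge (of SW/SE).
  degree : ℕ
  degree = b2n (NE ∨ SE) ℕ.+ b2n (NW ∨ SW) ℕ.+ b2n (NW ∨ NE) ℕ.+ b2n (SW ∨ SE)

-- d m ν : number of boundary vertices of ν of degree m.  All vertices
-- of cells of ν have (i , j) ∈ [0,w] × [0,h], so we count over that range.
d : ℕ → ConvexPolyomino → ℕ
d m ν = sum (concatMap (λ i → map (λ j → count (+ i) (+ j)) (upTo (suc h))) (upTo (suc w)))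
  where
    open ConvexPolyomino ν
    count : ℤ → ℤ → ℕ
    count i j = if isBoundary grid i j ∧ (degree grid i j ≡ᵇ m) then 1 else 0

-- The contribution of a vertex to d₂, d₃ and d₄ only depends on the 2 × 2 window of cells
-- around it.  A check of the 16 windows gives a local identity which, summed along the vertical
-- line of vertices between a column q and the column p to its right, reads
--   d₂ − d₄ on the line = changes(q) + changes(p) − 2 · changes(q ∧ p),
-- where changes counts the switches between empty and occupied along a column, provided the
-- line carries no diagonal window (two cells meeting only at a corner), which convexity rules out.
-- In a convex polyomino every column is an interval (two changes) and adjacent columns overlap,
-- so only the two outermost lines contribute, each 2: d₂ = d₄ + 4.  Hence d₂ + d₃ = n if and only
-- if d₃ + d₄ = n − 4, and both sides count the same set of polyominoes.  It is finite: width and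
-- height are at most the number d₂ + d₃ + d₄ ≤ 2n of boundary vertices, and being a convex
-- polyomino is decidable once connectivity is restated as overlap of adjacent columns.

module Submission where

open import Defs
open import Data.Bool using (Bool; true; false; _∧_; _∨_; _xor_; if_then_else_)
open import Data.Bool.Properties using (∨-zeroʳ; ∧-zeroʳ) renaming (_≟_ to _≟ᴮ_)
open import Data.Empty using (⊥; ⊥-elim; ⊥-elim-irr)
open import Data.Fin using (Fin; zero; suc; toℕ; fromℕ<)
open import Data.Fin.Properties using (+↔⊎; 2↔Bool; toℕ<n; toℕ-fromℕ<; fromℕ<-toℕ)
open import Data.Integer as ℤ using (+_; -[1+_]; +≤+)
import Data.Integer.Properties as ℤₚ
import Data.Irrelevant as Irr
open import Data.List using (List; []; _∷_; [_]; _++_; upTo; map; concatMap)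
open import Data.List.Properties using (map-++; upTo-∷ʳ)
open import Data.Nat as ℕ
  using (ℕ; zero; suc; _+_; _*_; _∸_; _≤_; _<_; _≤′_; ≤′-refl; ≤′-step; z≤n; s≤s; ∣_-_∣)
open import Data.Nat.ListAction using (sum)
open import Data.Nat.ListAction.Properties using (sum-++)
open import Data.Nat.Properties
open import Algebra.Properties.CommutativeSemigroup +-commutativeSemigroup using (interchange; xy∙z≈xz∙y)
open import Data.Product using (Σ; ∃; _×_; _,_; proj₁; proj₂)
open import Data.Product.Function.Dependent.Propositional using (Σ-↔)
open import Data.Sum using (_⊎_; inj₁; inj₂)
open import Data.Sum.Function.Propositional using (_⊎-↔_)
open import Data.Vec using (Vec; []; _∷_)
open import Function using (_∘_)
open import Function.Bundles using (_↔_; _⇔_; mk↔ₛ′; mk⇔; Inverse; Equivalence)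
open import Function.Properties.Inverse using (↔-refl; ↔-trans)
open import Function.Related.TypeIsomorphisms using (Σ-assoc)
open import Relation.Binary.PropositionalEquality
  using (_≡_; _≢_; refl; sym; trans; cong; cong₂; subst; subst₂; module ≡-Reasoning)
open import Relation.Nullary using (Dec; yes; no; ¬_; Irrelevant; recompute)
open import Relation.Nullary.Decidable using (map′; _×-dec_; _→-dec_)

indicator : Bool → ℕ
indicator b = if b then 1 else 0

∑< : ℕ → (ℕ → ℕ) → ℕ
∑< zero    f = 0
∑< (suc n) f = ∑< n f + f n

syntax ∑< n (λ j → e) = ∑[ j < n ] e

∑-cong : ∀ n {f g : ℕ → ℕ} → (∀ j → j < n → f j ≡ g j) → ∑< n f ≡ ∑< n g
∑-cong zero    eq = refl
∑-cong (suc n) eq = cong₂ _+_ (∑-cong n (λ j j<n → eq j (m<n⇒m<1+n j<n))) (eq n ≤-refl)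

∑-zero : ∀ n {f : ℕ → ℕ} → (∀ j → j < n → f j ≡ 0) → ∑< n f ≡ 0
∑-zero zero    eq = refl
∑-zero (suc n) eq = cong₂ _+_ (∑-zero n (λ j j<n → eq j (m<n⇒m<1+n j<n))) (eq n ≤-refl)

∑-distrib-+ : ∀ n (f g : ℕ → ℕ) → ∑[ j < n ] (f j + g j) ≡ ∑< n f + ∑< n g
∑-distrib-+ zero    f g = refl
∑-distrib-+ (suc n) f g =
  trans (cong (_+ (f n + g n)) (∑-distrib-+ n f g)) (interchange (∑< n f) (∑< n g) (f n) (g n))

∑-comm : ∀ a b (f : ℕ → ℕ → ℕ) → ∑[ i < a ] ∑[ j < b ] f i j ≡ ∑[ j < b ] ∑[ i < a ] f i j
∑-comm zero    b f = sym (∑-zero b (λ _ _ → refl))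
∑-comm (suc a) b f =
  trans (cong (_+ ∑< b (f a)) (∑-comm a b f)) (sym (∑-distrib-+ b (λ j → ∑[ i < a ] f i j) (f a)))

*-distribˡ-∑ : ∀ n k (f : ℕ → ℕ) → k * ∑< n f ≡ ∑[ j < n ] (k * f j)
*-distribˡ-∑ zero    k f = *-zeroʳ k
*-distribˡ-∑ (suc n) k f = trans (*-distribˡ-+ k (∑< n f) (f n)) (cong (_+ k * f n) (*-distribˡ-∑ n k f))

term≤∑ : ∀ n (f : ℕ → ℕ) {k} → k < n → f k ≤ ∑< n f
term≤∑ (suc n) f {k} k<1+n with k ≟ n
... | yes refl = m≤n+m (f k) (∑< n f)
... | no  k≢n  = ≤-trans (term≤∑ n f (≤∧≢⇒< (≤-pred k<1+n) k≢n)) (m≤m+n _ _)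

length≤∑ : ∀ n {f : ℕ → ℕ} → (∀ j → j < n → 1 ≤ f j) → n ≤ ∑< n f
length≤∑ zero    pos = z≤n
length≤∑ (suc n) {f} pos = subst (_≤ ∑< (suc n) f) (+-comm n 1)
  (+-mono-≤ (length≤∑ n (λ j j<n → pos j (m<n⇒m<1+n j<n))) (pos n ≤-refl))

∑-ends : ∀ n (f g : ℕ → ℕ) {a b} → f 0 ≡ g 0 + a → (∀ i → i < n → f (suc i) ≡ g (suc i)) →
         f (suc n) ≡ g (suc n) + b → ∑< (suc (suc n)) f ≡ ∑< (suc (suc n)) g + (a + b)
∑-ends n f g {a} {b} first middle last = begin
  ∑< (suc n) f + f (suc n)             ≡⟨ cong₂ _+_ (prefix n ≤-refl) last ⟩
  (∑< (suc n) g + a) + (g (suc n) + b)  ≡⟨ interchange (∑< (suc n) g) a (g (suc n)) b ⟩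
  ∑< (suc (suc n)) g + (a + b)          ∎
  where
  open ≡-Reasoning
  prefix : ∀ k → k ≤ n → ∑< (suc k) f ≡ ∑< (suc k) g + a
  prefix zero    _      = first
  prefix (suc k) 1+k≤n = begin
    ∑< (suc k) f + f (suc k)  ≡⟨ cong₂ _+_ (prefix k (≤-trans (n≤1+n k) 1+k≤n)) (middle k 1+k≤n) ⟩
    ∑< (suc k) g + a + g (suc k)  ≡⟨ xy∙z≈xz∙y (∑< (suc k) g) a (g (suc k)) ⟩
    ∑< (suc (suc k)) g + a        ∎

sum-map-upTo : ∀ n (f : ℕ → ℕ) → sum (map f (upTo n)) ≡ ∑< n f
sum-map-upTo zero    f = refl
sum-map-upTo (suc n) f = begin
  sum (map f (upTo (suc n)))        ≡⟨ cong (sum ∘ map f) (upTo-∷ʳ n) ⟨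
  sum (map f (upTo n ++ [ n ]))      ≡⟨ cong sum (map-++ f (upTo n) [ n ]) ⟩
  sum (map f (upTo n) ++ [ f n ])    ≡⟨ sum-++ (map f (upTo n)) [ f n ] ⟩
  sum (map f (upTo n)) + (f n + 0)   ≡⟨ cong₂ _+_ (sum-map-upTo n f) (+-identityʳ (f n)) ⟩
  ∑< (suc n) f                       ∎
  where open ≡-Reasoning

sum-concatMap : ∀ {A : Set} (F : A → List ℕ) xs → sum (concatMap F xs) ≡ sum (map (sum ∘ F) xs)
sum-concatMap F []       = refl
sum-concatMap F (x ∷ xs) = trans (sum-++ (F x) (concatMap F xs)) (cong (sum (F x) ℕ.+_) (sum-concatMap F xs))

true≢false : true ≢ false
true≢false ()

prev : (ℕ → Bool) → ℕ → Bool
prev f zero    = false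
prev f (suc j) = f j

prev-∧ : ∀ f g j → prev (λ i → f i ∧ g i) j ≡ (prev f j ∧ prev g j)
prev-∧ f g zero    = refl
prev-∧ f g (suc j) = refl

change : Bool → Bool → ℕ
change a b = indicator (a xor b)

changes : (ℕ → Bool) → ℕ → ℕ
changes f n = ∑[ j < n ] change (prev f j) (f j)

Contiguous : (ℕ → Bool) → Set
Contiguous f = ∀ {a b c} → a ≤ b → b ≤ c → f a ≡ true → f c ≡ true → f b ≡ true

contiguous-∧ : ∀ {f g} → Contiguous f → Contiguous g → Contiguous (λ j → f j ∧ g j)
contiguous-∧ {f} {g} cf cg {a} {b} {c} a≤b b≤c _ _ with f a in fa | g a in ga | f c in fc | g c in gc
... | true | true | true | true rewrite cf a≤b b≤c fa fc | cg a≤b b≤c ga gc = refl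

contiguous-empty : ∀ {f} → (∀ j → f j ≡ false) → Contiguous f
contiguous-empty {f} empty _ _ fa _ with () ← trans (sym fa) (empty _)

anyBelow : (ℕ → Bool) → ℕ → Bool
anyBelow f zero    = false
anyBelow f (suc n) = anyBelow f n ∨ f n

anyBelow-intro : ∀ f {n k} → k < n → f k ≡ true → anyBelow f n ≡ true
anyBelow-intro f {suc n} {k} k<1+n fk with k ≟ n
... | yes refl rewrite fk = ∨-zeroʳ (anyBelow f k)
... | no  k≢n  rewrite anyBelow-intro f (≤∧≢⇒< (≤-pred k<1+n) k≢n) fk = refl

anyBelow-elim : ∀ f n → anyBelow f n ≡ true → ∃ λ k → k < n × f k ≡ true
anyBelow-elim f (suc n) seen with anyBelow f n in seen′ | f n in fn
... | true  | _    = let k , k<n , fk = anyBelow-elim f n seen′ in k , m<n⇒m<1+n k<n , fk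
... | false | true = n , ≤-refl , fn

prev⇒anyBelow : ∀ f n → prev f n ≡ true → anyBelow f n ≡ true
prev⇒anyBelow f (suc n) fn = anyBelow-intro f ≤-refl fn

-- Read upwards from the `false` before 0, a contiguous sequence changes once on entering
-- its block and once on leaving it.
changes-contiguous : ∀ {f} → Contiguous f → ∀ n →
  changes f n ≡ (if anyBelow f n then (if prev f n then 1 else 2) else 0)
changes-contiguous cf zero = refl
changes-contiguous {f} cf (suc n) rewrite changes-contiguous cf n
  with anyBelow f n in seen | prev f n in last | f n in now
... | false | true  | _     with () ← trans (sym (prev⇒anyBelow f n last)) seen
... | false | false | true  = refl
... | false | false | false = refl
... | true  | true  | true  = refl
... | true  | true  | false = refl
... | true  | false | false = refl
... | true  | false | true  = ⊥-elim (no-return n seen last now)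
  where
  no-return : ∀ n → anyBelow f n ≡ true → prev f n ≡ false → f n ≡ true → ⊥
  no-return (suc m) seen last now with anyBelow-elim f (suc m) seen
  ... | k , k<1+m , fk with () ← trans (sym last) (cf (≤-pred k<1+m) (n≤1+n m) fk now)

changes-block : ∀ {f h y} → Contiguous f → f h ≡ false → y ≤ h → f y ≡ true → changes f (suc h) ≡ 2
changes-block {f} {h} cf fh y≤h fy
  rewrite changes-contiguous cf (suc h) | anyBelow-intro f (s≤s y≤h) fy | fh = refl

changes-empty : ∀ {f} n → (∀ j → f j ≡ false) → changes f n ≡ 0
changes-empty {f} n empty = ∑-zero n (λ j _ → no-change j)
  where
  no-change : ∀ j → change (prev f j) (f j) ≡ 0
  no-change zero    rewrite empty 0 = refl
  no-change (suc j) rewrite empty j | empty (suc j) = refl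

rise-below : ∀ f y → f y ≡ true → ∃ λ j → j ≤ y × f j ≡ true × prev f j ≡ false
rise-below f zero    fy = 0 , z≤n , fy , refl
rise-below f (suc y) fy with f y in fy′
... | true  = let j , j≤y , fj , below = rise-below f y fy′ in j , m≤n⇒m≤1+n j≤y , fj , below
... | false = suc y , ≤-refl , fy , fy′

-- The cells NE, NW, SE, SW of Defs around a vertex.
record Window : Set where
  constructor ⟨_,_,_,_⟩
  field ne nw se sw : Bool

open Window

-- The window as the 2 × 2 grid around its vertex (1 , 1): isBoundary and degree then apply
-- verbatim, and a vertex contributes to d m exactly the contribution m of its window.
windowGrid : Window → Grid 2 2
windowGrid ⟨ ne , nw , se , sw ⟩ = (sw ∷ se ∷ []) ∷ (nw ∷ ne ∷ []) ∷ []

boundary : Window → Bool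
boundary v = isBoundary (windowGrid v) (+ 1) (+ 1)

contribution : ℕ → Window → ℕ
contribution m v = if boundary v ∧ (degree (windowGrid v) (+ 1) (+ 1) ℕ.≡ᵇ m) then 1 else 0

diagonal : Window → ℕ
diagonal ⟨ true  , false , false , true  ⟩ = 1
diagonal ⟨ false , true  , true  , false ⟩ = 1
diagonal _                                 = 0

window-balance : ∀ v → contribution 2 v + 2 * change (sw v ∧ se v) (nw v ∧ ne v) + 3 * diagonal v
                       ≡ contribution 4 v + change (sw v) (nw v) + change (se v) (ne v)
window-balance ⟨ true  , true  , true  , true  ⟩ = refl
window-balance ⟨ true  , true  , true  , false ⟩ = refl
window-balance ⟨ true  , true  , false , true  ⟩ = refl
window-balance ⟨ true  , true  , false , false ⟩ = refl
window-balance ⟨ true  , false , true  , true  ⟩ = refl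
window-balance ⟨ true  , false , true  , false ⟩ = refl
window-balance ⟨ true  , false , false , true  ⟩ = refl
window-balance ⟨ true  , false , false , false ⟩ = refl
window-balance ⟨ false , true  , true  , true  ⟩ = refl
window-balance ⟨ false , true  , true  , false ⟩ = refl
window-balance ⟨ false , true  , false , true  ⟩ = refl
window-balance ⟨ false , true  , false , false ⟩ = refl
window-balance ⟨ false , false , true  , true  ⟩ = refl
window-balance ⟨ false , false , true  , false ⟩ = refl
window-balance ⟨ false , false , false , true  ⟩ = refl
window-balance ⟨ false , false , false , false ⟩ = refl

window-partition : ∀ v → contribution 2 v + contribution 3 v + contribution 4 v ≡ indicator (boundary v)
window-partition ⟨ true  , true  , true  , true  ⟩ = refl
window-partition ⟨ true  , true  , true  , false ⟩ = refl
window-partition ⟨ true  , true  , false , true  ⟩ = refl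
window-partition ⟨ true  , true  , false , false ⟩ = refl
window-partition ⟨ true  , false , true  , true  ⟩ = refl
window-partition ⟨ true  , false , true  , false ⟩ = refl
window-partition ⟨ true  , false , false , true  ⟩ = refl
window-partition ⟨ true  , false , false , false ⟩ = refl
window-partition ⟨ false , true  , true  , true  ⟩ = refl
window-partition ⟨ false , true  , true  , false ⟩ = refl
window-partition ⟨ false , true  , false , true  ⟩ = refl
window-partition ⟨ false , true  , false , false ⟩ = refl
window-partition ⟨ false , false , true  , true  ⟩ = refl
window-partition ⟨ false , false , true  , false ⟩ = refl
window-partition ⟨ false , false , false , true  ⟩ = refl
window-partition ⟨ false , false , false , false ⟩ = refl

boundary-below-cell : ∀ nw sw → boundary ⟨ true , nw , false , sw ⟩ ≡ true
boundary-below-cell true  sw = refl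
boundary-below-cell false sw = refl

boundary-left-of-cell : ∀ se sw → boundary ⟨ true , false , se , sw ⟩ ≡ true
boundary-left-of-cell se sw = refl

-- Lines of vertices between a column q and the column p to its right

lineWindow : (ℕ → Bool) → (ℕ → Bool) → ℕ → Window
lineWindow p q j = ⟨ p j , q j , prev p j , prev q j ⟩

dLine : ℕ → (ℕ → Bool) → (ℕ → Bool) → ℕ → ℕ
dLine m p q n = ∑[ j < n ] contribution m (lineWindow p q j)

-- The diagonal windows on a line are exactly the hand-overs between its two columns.
HandOver : (ℕ → Bool) → (ℕ → Bool) → ℕ → Set
HandOver f g j = prev f j ≡ true × f j ≡ false × prev g j ≡ false × g j ≡ true

diagonal-line : ∀ p q j → ¬ HandOver q p j → ¬ HandOver p q j → diagonal (lineWindow p q j) ≡ 0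
diagonal-line p q j ¬qp ¬pq with p j | q j | prev p j | prev q j
... | true  | false | false | true  = ⊥-elim (¬qp (refl , refl , refl , refl))
... | false | true  | true  | false = ⊥-elim (¬pq (refl , refl , refl , refl))
... | true  | true  | _     | _     = refl
... | true  | false | true  | _     = refl
... | true  | false | false | false = refl
... | false | false | _     | _     = refl
... | false | true  | false | _     = refl
... | false | true  | true  | true  = refl

empty⇒¬HandOver : ∀ {f g} → (∀ j → f j ≡ false) → ∀ j → ¬ HandOver f g j × ¬ HandOver g f j
empty⇒¬HandOver {f} empty j =
  (λ (before , _) → true≢false (trans (sym before) (prev-empty j))) ,
  (λ (_ , _ , _ , now) → true≢false (trans (sym now) (empty j)))
  where
  prev-empty : ∀ j → prev f j ≡ false
  prev-empty zero    = refl
  prev-empty (suc j) = empty j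

overlapping⇒¬HandOver : ∀ {f g r} → Contiguous f → Contiguous g → f r ≡ true → g r ≡ true →
                         ∀ j → ¬ HandOver f g j
overlapping⇒¬HandOver {r = r} cf cg fr gr (suc i) (fi , fi+1 , gi , gi+1) with r ≤? i
... | yes r≤i = true≢false (trans (sym (cg r≤i (n≤1+n i) gr gi+1)) gi)
... | no  r≰i = true≢false (trans (sym (cf (n≤1+n i) (≰⇒> r≰i) fi fr)) fi+1)

dLine-balance : ∀ p q n → (∀ j → ¬ HandOver q p j) → (∀ j → ¬ HandOver p q j) →
  dLine 2 p q n + 2 * changes (λ j → q j ∧ p j) n ≡ dLine 4 p q n + changes q n + changes p n
dLine-balance p q n ¬qp ¬pq = begin
  dLine 2 p q n + 2 * changes both n
    ≡⟨ cong (dLine 2 p q n ℕ.+_) (*-distribˡ-∑ n 2 _) ⟩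
  dLine 2 p q n + ∑[ j < n ] (2 * change (prev both j) (both j))
    ≡⟨ ∑-distrib-+ n _ _ ⟨
  ∑[ j < n ] (contribution 2 (lineWindow p q j) + 2 * change (prev both j) (both j))
    ≡⟨ ∑-cong n (λ j _ → at j) ⟩
  ∑[ j < n ] (contribution 4 (lineWindow p q j) + change (prev q j) (q j) + change (prev p j) (p j))
    ≡⟨ ∑-distrib-+ n _ _ ⟩
  ∑[ j < n ] (contribution 4 (lineWindow p q j) + change (prev q j) (q j)) + changes p n
    ≡⟨ cong (_+ changes p n) (∑-distrib-+ n _ _) ⟩
  dLine 4 p q n + changes q n + changes p n ∎
  where
  open ≡-Reasoning
  both = λ j → q j ∧ p j
  at : ∀ j → contribution 2 (lineWindow p q j) + 2 * change (prev both j) (both j)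
           ≡ contribution 4 (lineWindow p q j) + change (prev q j) (q j) + change (prev p j) (p j)
  at j = begin
    contribution 2 v + 2 * change (prev both j) (both j)
      ≡⟨ cong (λ b → contribution 2 v + 2 * change b (both j)) (prev-∧ q p j) ⟩
    lhs                        ≡⟨ +-identityʳ lhs ⟨
    lhs + 3 * 0                ≡⟨ cong (λ k → lhs + 3 * k) (diagonal-line p q j (¬qp j) (¬pq j)) ⟨
    lhs + 3 * diagonal v       ≡⟨ window-balance v ⟩
    contribution 4 v + change (sw v) (nw v) + change (se v) (ne v) ∎
    where
    v   = lineWindow p q j
    lhs = contribution 2 v + 2 * change (sw v ∧ se v) (nw v ∧ ne v)

dLine-balance-with : ∀ {p q n a b c} → (∀ j → ¬ HandOver q p j) → (∀ j → ¬ HandOver p q j) →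
  changes (λ j → q j ∧ p j) n ≡ c → changes q n ≡ a → changes p n ≡ b →
  dLine 2 p q n + 2 * c ≡ dLine 4 p q n + a + b
dLine-balance-with {p} {q} {n} ¬qp ¬pq refl refl refl = dLine-balance p q n ¬qp ¬pq

dLine-leftmost : ∀ {p q h y} → Contiguous p → p h ≡ false → y ≤ h → p y ≡ true → (∀ j → q j ≡ false) →
  dLine 2 p q (suc h) ≡ dLine 4 p q (suc h) + 2
dLine-leftmost {p} {q} {h} cp ph y≤h py empty = begin
  dLine 2 p q (suc h)          ≡⟨ +-identityʳ _ ⟨
  dLine 2 p q (suc h) + 2 * 0  ≡⟨ dLine-balance-with {p} {q} (proj₁ ∘ none) (proj₂ ∘ none) both q-changes p-changes ⟩
  dLine 4 p q (suc h) + 0 + 2  ≡⟨ cong (_+ 2) (+-identityʳ _) ⟩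
  dLine 4 p q (suc h) + 2      ∎
  where
  open ≡-Reasoning
  none      = empty⇒¬HandOver {g = p} empty
  both      = changes-empty (suc h) (λ j → cong (_∧ p j) (empty j))
  q-changes = changes-empty (suc h) empty
  p-changes = changes-block cp ph y≤h py

dLine-rightmost : ∀ {p q h y} → Contiguous q → q h ≡ false → y ≤ h → q y ≡ true → (∀ j → p j ≡ false) →
  dLine 2 p q (suc h) ≡ dLine 4 p q (suc h) + 2
dLine-rightmost {p} {q} {h} cq qh y≤h qy empty = begin
  dLine 2 p q (suc h)          ≡⟨ +-identityʳ _ ⟨
  dLine 2 p q (suc h) + 2 * 0  ≡⟨ dLine-balance-with {p} {q} (proj₂ ∘ none) (proj₁ ∘ none) both q-changes p-changes ⟩
  dLine 4 p q (suc h) + 2 + 0  ≡⟨ +-identityʳ _ ⟩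
  dLine 4 p q (suc h) + 2      ∎
  where
  open ≡-Reasoning
  none      = empty⇒¬HandOver {g = q} empty
  both      = changes-empty (suc h) (λ j → trans (cong (q j ∧_) (empty j)) (∧-zeroʳ (q j)))
  q-changes = changes-block cq qh y≤h qy
  p-changes = changes-empty (suc h) empty

dLine-inner : ∀ {p q h y} → Contiguous p → Contiguous q → p h ≡ false → q h ≡ false → y ≤ h →
  p y ≡ true → q y ≡ true → dLine 2 p q (suc h) ≡ dLine 4 p q (suc h)
dLine-inner {p} {q} {h} cp cq ph qh y≤h py qy = +-cancelʳ-≡ _ _ _ (begin
  dLine 2 p q (suc h) + 2 * 2  ≡⟨ dLine-balance-with {p} {q} ¬qp ¬pq both q-changes p-changes ⟩
  dLine 4 p q (suc h) + 2 + 2  ≡⟨ +-assoc _ 2 2 ⟩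
  dLine 4 p q (suc h) + 4      ∎)
  where
  open ≡-Reasoning
  ¬qp       = overlapping⇒¬HandOver cq cp qy py
  ¬pq       = overlapping⇒¬HandOver cp cq py qy
  both      = changes-block (contiguous-∧ cq cp) (cong (_∧ p h) qh) y≤h (cong₂ _∧_ qy py)
  q-changes = changes-block cq qh y≤h qy
  p-changes = changes-block cp ph y≤h py

column : ∀ {w h} → Grid w h → ℕ → ℕ → Bool
column g x y = cellAt g (+ x) (+ y)

-- Column x - 1; for x = 0 this is the (empty) column -1.
leftColumn : ∀ {w h} → Grid w h → ℕ → ℕ → Bool
leftColumn g x y = cellAt g (+ x ℤ.- ℤ.1ℤ) (+ y)

row : ∀ {w h} → Grid w h → ℕ → ℕ → Bool
row g y x = column g x y

vertexWindow : ∀ {w h} → Grid w h → ℕ → ℕ → Window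
vertexWindow g i = lineWindow (column g i) (leftColumn g i)

cellAt-bounded : ∀ {w h} (g : Grid w h) X Y → cellAt g X Y ≡ true →
  Σ ℕ λ x → Σ ℕ λ y → X ≡ + x × Y ≡ + y × x < w × y < h
cellAt-bounded {w} {h} g (+ x) (+ y) e with x <? w | y <? h
... | yes x<w | yes y<h = x , y , refl , refl , x<w , y<h

column-bounded : ∀ {w h} (g : Grid w h) {x y} → column g x y ≡ true → x < w × y < h
column-bounded g e with cellAt-bounded g _ _ e
... | _ , _ , refl , refl , x<w , y<h = x<w , y<h

column-aboveTop : ∀ {w h} (g : Grid w h) {x y} → h ≤ y → column g x y ≡ false
column-aboveTop g {x} {y} h≤y with column g x y in e
... | true  = ⊥-elim (<⇒≱ (proj₂ (column-bounded g e)) h≤y)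
... | false = refl

column-pastRight : ∀ {w h} (g : Grid w h) {x y} → w ≤ x → column g x y ≡ false
column-pastRight g {x} {y} w≤x with column g x y in e
... | true  = ⊥-elim (<⇒≱ (proj₁ (column-bounded g e)) w≤x)
... | false = refl

cellAt-belowBottom : ∀ {w h} (g : Grid w h) X n → cellAt g X -[1+ n ] ≡ false
cellAt-belowBottom g (+ x)    n = refl
cellAt-belowBottom g -[1+ x ] n = refl

cellAt-below : ∀ {w h} (g : Grid w h) X j → cellAt g X (+ j ℤ.- ℤ.1ℤ) ≡ prev (λ y → cellAt g X (+ y)) j
cellAt-below g X zero    = cellAt-belowBottom g X 0
cellAt-below g X (suc j) = refl

occupied-ℕ : ∀ {w h} (g : Grid w h) {X} → (∃ λ Y → (X , Y) ∈G g) → ∃ λ y → cellAt g X (+ y) ≡ true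
occupied-ℕ g {X} (+ y , e)     = y , e
occupied-ℕ g {X} (-[1+ n ] , e) = ⊥-elim (true≢false (trans (sym e) (cellAt-belowBottom g X n)))

colConvex⇒contiguous : ∀ {w h} (g : Grid w h) → ColConvex g → ∀ x → Contiguous (column g x)
colConvex⇒contiguous g cc x a≤b b≤c fa fc = cc (+ x) _ _ _ fa fc (+≤+ a≤b) (+≤+ b≤c)

rowConvex⇒contiguous : ∀ {w h} (g : Grid w h) → RowConvex g → ∀ y → Contiguous (row g y)
rowConvex⇒contiguous g rc y a≤b b≤c fa fc = rc _ _ _ (+ y) fa fc (+≤+ a≤b) (+≤+ b≤c)

contiguous⇒colConvex : ∀ {w h} (g : Grid w h) → (∀ x → Contiguous (column g x)) → ColConvex g
contiguous⇒colConvex g cols X Y₁ Y Y₂ e₁ e₂ Y₁≤Y Y≤Y₂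
  with cellAt-bounded g X Y₁ e₁ | cellAt-bounded g X Y₂ e₂
... | x , _ , refl , refl , _ | _ , _ , _ , refl , _ with Y₁≤Y | Y≤Y₂
... | +≤+ a≤b | +≤+ b≤c = cols x a≤b b≤c e₁ e₂

contiguous⇒rowConvex : ∀ {w h} (g : Grid w h) → (∀ y → Contiguous (row g y)) → RowConvex g
contiguous⇒rowConvex g rows X₁ X X₂ Y e₁ e₂ X₁≤X X≤X₂
  with cellAt-bounded g X₁ Y e₁ | cellAt-bounded g X₂ Y e₂
... | _ , y , refl , refl , _ | _ , _ , refl , _ , _ with X₁≤X | X≤X₂
... | +≤+ a≤b | +≤+ b≤c = rows y a≤b b≤c e₁ e₂

dGrid : ℕ → ∀ {w h} → Grid w h → ℕ
dGrid m {w} {h} g = ∑[ i < suc w ] dLine m (column g i) (leftColumn g i) (suc h)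

d≡dGrid : ∀ m ν → d m ν ≡ dGrid m (ConvexPolyomino.grid ν)
d≡dGrid m ν = begin
  d m ν                                    ≡⟨ sum-concatMap counts (upTo (suc w)) ⟩
  sum (map (sum ∘ counts) (upTo (suc w)))  ≡⟨ sum-map-upTo (suc w) _ ⟩
  ∑[ i < suc w ] sum (counts i)            ≡⟨ ∑-cong (suc w) (λ i _ → line i) ⟩
  dGrid m grid                             ∎
  where
  open ConvexPolyomino ν
  open ≡-Reasoning
  window : ℕ → ℕ → Window
  window i j = ⟨ cellAt grid (+ i) (+ j) , cellAt grid (+ i ℤ.- ℤ.1ℤ) (+ j) ,
                 cellAt grid (+ i) (+ j ℤ.- ℤ.1ℤ) , cellAt grid (+ i ℤ.- ℤ.1ℤ) (+ j ℤ.- ℤ.1ℤ) ⟩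
  counts : ℕ → List ℕ
  counts i = map (λ j → contribution m (window i j)) (upTo (suc h))
  line : ∀ i → sum (counts i) ≡ dLine m (column grid i) (leftColumn grid i) (suc h)
  line i = trans (sum-map-upTo (suc h) _) (∑-cong (suc h) λ j _ → cong (contribution m)
    (cong₂ (λ se sw → ⟨ column grid i j , leftColumn grid i j , se , sw ⟩)
           (cellAt-below grid (+ i) j) (cellAt-below grid (+ i ℤ.- ℤ.1ℤ) j)))

∣m⊖n∣≡∣m-n∣ : ∀ m n → ℤ.∣ m ℤ.⊖ n ∣ ≡ ∣ m - n ∣
∣m⊖n∣≡∣m-n∣ zero    zero    = refl
∣m⊖n∣≡∣m-n∣ zero    (suc n) = refl
∣m⊖n∣≡∣m-n∣ (suc m) zero    = refl
∣m⊖n∣≡∣m-n∣ (suc m) (suc n) = trans (cong ℤ.∣_∣ (ℤₚ.[1+m]⊖[1+n]≡m⊖n m n)) (∣m⊖n∣≡∣m-n∣ m n)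

∣+m-+n∣≡∣m-n∣ : ∀ m n → ℤ.∣ + m ℤ.- + n ∣ ≡ ∣ m - n ∣
∣+m-+n∣≡∣m-n∣ m n = trans (cong ℤ.∣_∣ (ℤₚ.[+m]-[+n]≡m⊖n m n)) (∣m⊖n∣≡∣m-n∣ m n)

Adj⇔ℕ : ∀ a b c d → Adj (+ a , + c) (+ b , + d) ⇔ (∣ a - b ∣ + ∣ c - d ∣ ≡ 1)
Adj⇔ℕ a b c d = mk⇔ (trans (sym coords)) (trans coords)
  where coords = cong₂ _+_ (∣+m-+n∣≡∣m-n∣ a b) (∣+m-+n∣≡∣m-n∣ c d)

Adj-sym : ∀ a b → Adj a b → Adj b a
Adj-sym (xa , ya) (xb , yb) = trans (cong₂ _+_ (ℤₚ.∣i-j∣≡∣j-i∣ xb xa) (ℤₚ.∣i-j∣≡∣j-i∣ yb ya))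

∣n-1+n∣≡1 : ∀ n → ∣ n - suc n ∣ ≡ 1
∣n-1+n∣≡1 zero    = refl
∣n-1+n∣≡1 (suc n) = ∣n-1+n∣≡1 n

adjacent-up : ∀ x y → Adj (+ x , + y) (+ x , + suc y)
adjacent-up x y = Equivalence.from (Adj⇔ℕ x x y (suc y)) (cong₂ _+_ (∣n-n∣≡0 x) (∣n-1+n∣≡1 y))

adjacent-right : ∀ x y → Adj (+ x , + y) (+ suc x , + y)
adjacent-right x y = Equivalence.from (Adj⇔ℕ x (suc x) y y) (cong₂ _+_ (∣n-1+n∣≡1 x) (∣n-n∣≡0 y))

adjacent-across : ∀ {a b c d k} → a ≤ k → k < b → ∣ a - b ∣ + ∣ c - d ∣ ≡ 1 → a ≡ k × b ≡ suc k × c ≡ d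
adjacent-across {a} {b} {c} {d} {k} a≤k k<b adj with ∣ a - b ∣ in ab | ∣ c - d ∣ in cd | adj
... | zero        | _      | _  = ⊥-elim (<⇒≢ (≤-<-trans a≤k k<b) (∣m-n∣≡0⇒m≡n ab))
... | suc zero    | suc _  | ()
... | suc (suc _) | _      | ()
... | suc zero    | zero   | _  = a≡k , trans b≡1+a (cong suc a≡k) , ∣m-n∣≡0⇒m≡n cd
  where
  a≤b = ≤-trans a≤k (<⇒≤ k<b)
  b≡1+a : b ≡ suc a
  b≡1+a = trans (sym (m∸n+n≡m a≤b)) (cong (_+ a) (trans (sym (m≤n⇒∣m-n∣≡n∸m a≤b)) ab))
  a≡k = ≤-antisym a≤k (≤-pred (subst (suc k ≤_) b≡1+a k<b))

module _ {w h} {g : Grid w h} where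

  pathStart : ∀ {a c} → Path g a c → a ∈G g
  pathStart (here a∈)     = a∈
  pathStart (step a∈ _ _) = a∈

  _++ᴾ_ : ∀ {a b c} → Path g a b → Path g b c → Path g a c
  here _       ++ᴾ q = q
  step a∈ ab p ++ᴾ q = step a∈ ab (p ++ᴾ q)

  reverseᴾ : ∀ {a b} → Path g a b → Path g b a
  reverseᴾ (here a∈)       = here a∈
  reverseᴾ (step {a} {b} a∈ ab p) = reverseᴾ p ++ᴾ step (pathStart p) (Adj-sym a b ab) (here a∈)

Overlap : ∀ {w h} → Grid w h → ℕ → Set
Overlap g k = ∃ λ y → column g k y ≡ true × column g (suc k) y ≡ true

ColumnsOverlap : ∀ {w h} → Grid w h → Set
ColumnsOverlap {w} g = ∀ k → suc k < w → Overlap g k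

path-crosses : ∀ {w h} (g : Grid w h) k {a c} → Path g a c →
  proj₁ a ℤ.≤ + k → + suc k ℤ.≤ proj₁ c → Overlap g k
path-crosses g k (here _) a≤k k<a = ⊥-elim (1+n≰n (ℤₚ.drop‿+≤+ (ℤₚ.≤-trans k<a a≤k)))
path-crosses g k (step {xa , ya} {xb , yb} a∈ adj p) a≤k k<c with xb ℤₚ.≤? + k
... | yes b≤k = path-crosses g k p b≤k k<c
... | no  b≰k with cellAt-bounded g xa ya a∈ | cellAt-bounded g xb yb (pathStart p)
... | xa′ , y , refl , refl , _ | xb′ , y′ , refl , refl , _
    with adjacent-across {c = y} {d = y′} (ℤₚ.drop‿+≤+ a≤k) (ℤₚ.drop‿+<+ (ℤₚ.≰⇒> b≰k))
                         (Equivalence.to (Adj⇔ℕ xa′ xb′ y y′) adj)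
... | refl , refl , refl = y , a∈ , pathStart p

path-meetsRow : ∀ {w h} (g : Grid w h) y {a c} → Path g a c →
  proj₂ a ℤ.≤ + y → + y ℤ.≤ proj₂ c → ∃ λ x → row g y x ≡ true
path-meetsRow g y (here {xa , ya} a∈) a≤y y≤a with cellAt-bounded g xa ya a∈
... | x , _ , refl , refl , _ with ≤-antisym (ℤₚ.drop‿+≤+ a≤y) (ℤₚ.drop‿+≤+ y≤a)
... | refl = x , a∈
path-meetsRow g y (step {xa , ya} {xb , yb} a∈ adj p) a≤y y≤c
  with cellAt-bounded g xa ya a∈ | cellAt-bounded g xb yb (pathStart p)
... | x , ra , refl , refl , _ | x′ , rb , refl , refl , _ with ra ≟ y
... | yes refl = x , a∈
... | no  ra≢y = path-meetsRow g y p (+≤+ rb≤y) y≤c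
  where
  ∣ra-rb∣≤1 : ∣ ra - rb ∣ ≤ 1
  ∣ra-rb∣≤1 = subst (∣ ra - rb ∣ ≤_) (Equivalence.to (Adj⇔ℕ x x′ ra rb) adj) (m≤n+m _ _)
  rb≤y : rb ≤ y
  rb≤y = ≤-trans (m≤n+∣n-m∣ rb ra) (≤-trans (+-monoʳ-≤ ra ∣ra-rb∣≤1)
           (subst (_≤ y) (+-comm 1 ra) (≤∧≢⇒< (ℤₚ.drop‿+≤+ a≤y) ra≢y)))

connected⇒columnsOverlap : ∀ {w h} (g : Grid w h) → Connected g →
  (∃ λ y → (+ 0 , y) ∈G g) → (∃ λ y → (+ w ℤ.- ℤ.1ℤ , y) ∈G g) → ColumnsOverlap g
connected⇒columnsOverlap {suc w′} g conn left right k 1+k<w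
  with occupied-ℕ g left | occupied-ℕ g right
... | y₀ , e₀ | y₁ , e₁ =
  path-crosses g k (conn (+ 0 , + y₀) (+ w′ , + y₁) e₀ e₁) (+≤+ z≤n) (+≤+ (≤-pred 1+k<w))

connected⇒rowsOccupied : ∀ {w h} (g : Grid w h) → Connected g →
  (∃ λ x → (x , + 0) ∈G g) → (∃ λ x → (x , + h ℤ.- ℤ.1ℤ) ∈G g) →
  ∀ y → y < h → ∃ λ x → row g y x ≡ true
connected⇒rowsOccupied {h = suc h′} g conn (X₀ , e₀) (X₁ , e₁) y y<h
  with cellAt-bounded g X₀ (+ 0) e₀ | cellAt-bounded g X₁ (+ h′) e₁
... | x₀ , _ , refl , refl , _ | x₁ , _ , refl , refl , _ =
  path-meetsRow g y (conn (+ x₀ , + 0) (+ x₁ , + h′) e₀ e₁) (+≤+ z≤n) (+≤+ (≤-pred y<h))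

columnsOverlap⇒columnsOccupied : ∀ {w h} (g : Grid w h) → (∃ λ y → (+ 0 , y) ∈G g) →
  ColumnsOverlap g → ∀ x → x < w → ∃ λ y → column g x y ≡ true
columnsOverlap⇒columnsOccupied g left overlaps zero    _     = occupied-ℕ g left
columnsOverlap⇒columnsOccupied g left overlaps (suc k) 1+k<w =
  let y , _ , c = overlaps k 1+k<w in y , c

module _ {w h} (g : Grid w h) (cols : ∀ x → Contiguous (column g x)) where

  columnPath-up : ∀ {x y₁ y₂} → y₁ ≤′ y₂ → column g x y₁ ≡ true → column g x y₂ ≡ true →
    Path g (+ x , + y₁) (+ x , + y₂)
  columnPath-up ≤′-refl c₁ _ = here c₁
  columnPath-up {x} (≤′-step {y} y₁≤′y) c₁ c₂ =
    columnPath-up y₁≤′y c₁ c ++ᴾ step c (adjacent-up x y) (here c₂)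
    where c = cols x (≤′⇒≤ y₁≤′y) (n≤1+n y) c₁ c₂

  columnPath : ∀ {x y₁ y₂} → column g x y₁ ≡ true → column g x y₂ ≡ true →
    Path g (+ x , + y₁) (+ x , + y₂)
  columnPath {y₁ = y₁} {y₂} c₁ c₂ with ≤-total y₁ y₂
  ... | inj₁ y₁≤y₂ = columnPath-up (≤⇒≤′ y₁≤y₂) c₁ c₂
  ... | inj₂ y₂≤y₁ = reverseᴾ (columnPath-up (≤⇒≤′ y₂≤y₁) c₂ c₁)

  -- Every cell is joined to a fixed cell of column 0, moving within a column and
  -- through the overlap with the column to its left.
  columnsOverlap⇒connected : (∃ λ y → (+ 0 , y) ∈G g) → ColumnsOverlap g → Connected g
  columnsOverlap⇒connected left overlaps (xa , ya) (xb , yb) a∈ b∈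
    with cellAt-bounded g xa ya a∈ | cellAt-bounded g xb yb b∈
  ... | _ , _ , refl , refl , _ | _ , _ , refl , refl , _ = toHub _ a∈ ++ᴾ reverseᴾ (toHub _ b∈)
    where
    hub = occupied-ℕ g left
    toHub : ∀ x {y} → column g x y ≡ true → Path g (+ x , + y) (+ 0 , + proj₁ hub)
    toHub zero    c = columnPath c (proj₂ hub)
    toHub (suc k) c with overlaps k (proj₁ (column-bounded g c))
    ... | y , ck , ck+1 =
      columnPath c ck+1 ++ᴾ step ck+1 (Adj-sym (+ k , + y) (+ suc k , + y) (adjacent-right k y)) (toHub k ck)

dGrid₂≡dGrid₄+4 : ∀ {w h} (g : Grid w h) → (∀ x → Contiguous (column g x)) →
  (∃ λ y → (+ 0 , y) ∈G g) → (∃ λ y → (+ w ℤ.- ℤ.1ℤ , y) ∈G g) → ColumnsOverlap g →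
  dGrid 2 g ≡ dGrid 4 g + 4
dGrid₂≡dGrid₄+4 {zero} g _ _ (_ , ()) _
dGrid₂≡dGrid₄+4 {suc w′} {h} g cols left right overlaps =
  ∑-ends w′ (line 2) (line 4) leftmost inner rightmost
  where
  line : ℕ → ℕ → ℕ
  line m i = dLine m (column g i) (leftColumn g i) (suc h)
  top : ∀ x → column g x h ≡ false
  top x = column-aboveTop g {x} ≤-refl
  below-top : ∀ x {y} → column g x y ≡ true → y ≤ h
  below-top x c = <⇒≤ (proj₂ (column-bounded g {x} c))
  leftmost : line 2 0 ≡ line 4 0 + 2
  leftmost = let _ , c = occupied-ℕ g left in dLine-leftmost (cols 0) (top 0) (below-top 0 c) c (λ _ → refl)
  inner : ∀ i → i < w′ → line 2 (suc i) ≡ line 4 (suc i)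
  inner i i<w′ = let _ , ci , ci+1 = overlaps i (s≤s i<w′) in
    dLine-inner (cols (suc i)) (cols i) (top (suc i)) (top i) (below-top i ci) ci+1 ci
  rightmost : line 2 (suc w′) ≡ line 4 (suc w′) + 2
  rightmost = let _ , c = occupied-ℕ g right in
    dLine-rightmost (cols w′) (top w′) (below-top w′ c) c (λ y → column-pastRight g {suc w′} {y} ≤-refl)

-- The fields of a ConvexPolyomino are irrelevant, so facts derived from them are recomputed
-- through a decision procedure.
d₂≡d₄+4 : ∀ ν → d 2 ν ≡ d 4 ν + 4
d₂≡d₄+4 ν@record { grid = g ; touchLeft = left ; touchRight = right ; connected = conn ; colConvex = cc } =
  recompute (d 2 ν ≟ d 4 ν + 4) (begin
    d 2 ν          ≡⟨ d≡dGrid 2 ν ⟩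
    dGrid 2 g      ≡⟨ dGrid₂≡dGrid₄+4 g (colConvex⇒contiguous g cc) left right
                        (connected⇒columnsOverlap g conn left right) ⟩
    dGrid 4 g + 4  ≡⟨ cong (_+ 4) (d≡dGrid 4 ν) ⟨
    d 4 ν + 4      ∎)
  where open ≡-Reasoning

-- Bounding width and height by the number of boundary vertices

boundaryCount : ∀ {w h} → Grid w h → ℕ
boundaryCount {w} {h} g = ∑[ i < suc w ] ∑[ j < suc h ] indicator (boundary (vertexWindow g i j))

∑-+₃ : ∀ n (f g k : ℕ → ℕ) → ∑< n f + ∑< n g + ∑< n k ≡ ∑[ j < n ] (f j + g j + k j)
∑-+₃ n f g k = trans (cong (_+ ∑< n k) (sym (∑-distrib-+ n f g))) (sym (∑-distrib-+ n _ k))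

dGrid-partition : ∀ {w h} (g : Grid w h) → dGrid 2 g + dGrid 3 g + dGrid 4 g ≡ boundaryCount g
dGrid-partition {w} {h} g = trans (∑-+₃ (suc w) (line 2) (line 3) (line 4))
  (∑-cong (suc w) λ i _ → trans (∑-+₃ (suc h) (window 2 i) (window 3 i) (window 4 i))
    (∑-cong (suc h) λ j _ → window-partition (vertexWindow g i j)))
  where
  window : ℕ → ℕ → ℕ → ℕ
  window m i j = contribution m (vertexWindow g i j)
  line : ℕ → ℕ → ℕ
  line m i = dLine m (column g i) (leftColumn g i) (suc h)

leftColumn≡prev : ∀ {w h} (g : Grid w h) i j → leftColumn g i j ≡ prev (row g j) i
leftColumn≡prev g zero    j = refl
leftColumn≡prev g (suc i) j = refl

1≤∑indicator : ∀ n (f : ℕ → Bool) {k} → k < n → f k ≡ true → 1 ≤ ∑[ j < n ] indicator (f j)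
1≤∑indicator n f k<n fk = ≤-trans (≤-reflexive (cong indicator (sym fk))) (term≤∑ n (indicator ∘ f) k<n)

-- Below the lowest cell of each column lies a boundary vertex.
width≤boundaryCount : ∀ {w h} (g : Grid w h) → (∀ x → x < w → ∃ λ y → column g x y ≡ true) →
  w ≤ boundaryCount g
width≤boundaryCount {w} {h} g occupied =
  ≤-trans (length≤∑ w λ i i<w → columnHasBoundary i (occupied i i<w)) (m≤m+n _ _)
  where
  columnHasBoundary : ∀ i → ∃ (λ y → column g i y ≡ true) →
    1 ≤ ∑[ j < suc h ] indicator (boundary (vertexWindow g i j))
  columnHasBoundary i (y , c) with rise-below (column g i) y c
  ... | j , j≤y , cj , below = 1≤∑indicator (suc h) (boundary ∘ vertexWindow g i) j<1+h bottomVertex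
    where
    j<1+h = s≤s (≤-trans j≤y (<⇒≤ (proj₂ (column-bounded g c))))
    bottomVertex : boundary (vertexWindow g i j) ≡ true
    bottomVertex rewrite cj | below = boundary-below-cell (leftColumn g i j) (prev (leftColumn g i) j)

-- Left of the leftmost cell of each row lies a boundary vertex.
height≤boundaryCount : ∀ {w h} (g : Grid w h) → (∀ y → y < h → ∃ λ x → row g y x ≡ true) →
  h ≤ boundaryCount g
height≤boundaryCount {w} {h} g occupied = begin
  h                                               ≤⟨ length≤∑ h (λ j j<h → rowHasBoundary j (occupied j j<h)) ⟩
  ∑[ j < h ] ∑[ i < suc w ] indicator (B i j)      ≤⟨ m≤m+n _ _ ⟩
  ∑[ j < suc h ] ∑[ i < suc w ] indicator (B i j)  ≡⟨ ∑-comm (suc w) (suc h) (λ i j → indicator (B i j)) ⟨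
  boundaryCount g                                 ∎
  where
  open ≤-Reasoning
  B : ℕ → ℕ → Bool
  B i j = boundary (vertexWindow g i j)
  rowHasBoundary : ∀ j → ∃ (λ x → row g j x ≡ true) → 1 ≤ ∑[ i < suc w ] indicator (B i j)
  rowHasBoundary j (x , c) with rise-below (row g j) x c
  ... | i , i≤x , ci , left = 1≤∑indicator (suc w) (λ i → B i j) i<1+w leftVertex
    where
    i<1+w = s≤s (≤-trans i≤x (<⇒≤ (proj₁ (column-bounded g c))))
    leftVertex : boundary (vertexWindow g i j) ≡ true
    leftVertex rewrite ci | leftColumn≡prev g i j | left =
      boundary-left-of-cell (prev (column g i) j) (prev (leftColumn g i) j)

boundaryCount≤ : ∀ {w h} (g : Grid w h) {n} → dGrid 2 g ≡ dGrid 4 g + 4 → dGrid 2 g + dGrid 3 g ≡ n →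
  boundaryCount g ≤ n + n
boundaryCount≤ g {n} d₂≡d₄+4 d₂+d₃≡n = begin
  boundaryCount g                    ≡⟨ dGrid-partition g ⟨
  dGrid 2 g + dGrid 3 g + dGrid 4 g  ≡⟨ cong (_+ dGrid 4 g) d₂+d₃≡n ⟩
  n + dGrid 4 g                      ≤⟨ +-monoʳ-≤ n d₄≤n ⟩
  n + n                              ∎
  where
  open ≤-Reasoning
  d₄≤n : dGrid 4 g ≤ n
  d₄≤n = begin
    dGrid 4 g              ≤⟨ m≤m+n _ 4 ⟩
    dGrid 4 g + 4          ≡⟨ d₂≡d₄+4 ⟨
    dGrid 2 g              ≤⟨ m≤m+n _ _ ⟩
    dGrid 2 g + dGrid 3 g  ≡⟨ d₂+d₃≡n ⟩
    n                      ∎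

dimensions≤ : ∀ ν {n} → d 2 ν + d 3 ν ≡ n → ConvexPolyomino.w ν ≤ n + n × ConvexPolyomino.h ν ≤ n + n
dimensions≤ ν@record { w = w ; h = h ; grid = g ; touchLeft = left ; touchBottom = bottom ; touchRight = right
                     ; touchTop = top ; connected = conn ; colConvex = cc } {n} d₂+d₃≡n =
  recompute ((w ≤? n + n) ×-dec (h ≤? n + n))
    (let overlaps = connected⇒columnsOverlap g conn left right
         size     = boundaryCount≤ g (dGrid₂≡dGrid₄+4 g (colConvex⇒contiguous g cc) left right overlaps)
                      (trans (cong₂ _+_ (sym (d≡dGrid 2 ν)) (sym (d≡dGrid 3 ν))) d₂+d₃≡n)
     in ≤-trans (width≤boundaryCount g (columnsOverlap⇒columnsOccupied g left overlaps)) size ,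
        ≤-trans (height≤boundaryCount g (connected⇒rowsOccupied g conn bottom top)) size)

-- Deciding whether a grid is a convex polyomino

∀? : ∀ n {P : ℕ → Set} → (∀ x → n ≤ x → P x) → (∀ x → Dec (P x)) → Dec (∀ x → P x)
∀? n {P} beyond P? = map′ extend (λ all {x} _ → all x) (allUpTo? P? n)
  where
  extend : (∀ {x} → x < n → P x) → ∀ x → P x
  extend below x with x <? n
  ... | yes x<n = below x<n
  ... | no  x≮n = beyond x (≮⇒≥ x≮n)

∃? : ∀ n {P : ℕ → Set} → (∀ x → P x → x < n) → (∀ x → Dec (P x)) → Dec (∃ P)
∃? n bounded P? = map′ (λ (x , _ , p) → x , p) (λ (x , p) → x , bounded x p , p) (anyUpTo? P? n)

contiguous? : ∀ n (f : ℕ → Bool) → (∀ j → n ≤ j → f j ≡ false) → Dec (Contiguous f)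
contiguous? n f vanish = map′ (λ c {a} {b} {c′} → c a b c′) (λ c a b c′ → c) (
  ∀? n (λ a n≤a _ _ _ _ fa _ → absurd a n≤a fa) λ a →
  ∀? n (λ b n≤b c _ b≤c _ fc → absurd c (≤-trans n≤b b≤c) fc) λ b →
  ∀? n (λ c n≤c _ _ _ fc → absurd c n≤c fc) λ c →
  (a ≤? b) →-dec (b ≤? c) →-dec (f a ≟ᴮ true) →-dec (f c ≟ᴮ true) →-dec (f b ≟ᴮ true))
  where
  absurd : ∀ {A : Set} j → n ≤ j → f j ≡ true → A
  absurd j n≤j fj = ⊥-elim (true≢false (trans (sym fj) (vanish j n≤j)))

columnOccupied? : ∀ {w h} (g : Grid w h) X → Dec (∃ λ Y → (X , Y) ∈G g)
columnOccupied? {h = h} g X =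
  map′ (λ (y , e) → + y , e) (occupied-ℕ g {X}) (∃? h bounded λ y → cellAt g X (+ y) ≟ᴮ true)
  where
  bounded : ∀ y → cellAt g X (+ y) ≡ true → y < h
  bounded y e with cellAt-bounded g X (+ y) e
  ... | _ , _ , _ , refl , _ , y<h = y<h

rowOccupied? : ∀ {w h} (g : Grid w h) Y → Dec (∃ λ X → (X , Y) ∈G g)
rowOccupied? {w} g Y = map′ (λ (x , e) → + x , e) natural (∃? w bounded λ x → cellAt g (+ x) Y ≟ᴮ true)
  where
  bounded : ∀ x → cellAt g (+ x) Y ≡ true → x < w
  bounded x e with cellAt-bounded g (+ x) Y e
  ... | _ , _ , refl , _ , x<w , _ = x<w
  natural : (∃ λ X → (X , Y) ∈G g) → ∃ λ x → cellAt g (+ x) Y ≡ true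
  natural (+ x , e) = x , e

overlap? : ∀ {w h} (g : Grid w h) k → Dec (Overlap g k)
overlap? {h = h} g k = ∃? h (λ y (c , _) → proj₂ (column-bounded g c))
  λ y → (column g k y ≟ᴮ true) ×-dec (column g (suc k) y ≟ᴮ true)

columnsOverlap? : ∀ {w h} (g : Grid w h) → Dec (ColumnsOverlap g)
columnsOverlap? {w} g = ∀? w (λ k w≤k 1+k<w → ⊥-elim (<⇒≱ (<-trans (n<1+n k) 1+k<w) w≤k))
  λ k → (suc k <? w) →-dec overlap? g k

-- Equivalent to the conditions of ConvexPolyomino, with connectivity replaced by the overlap
-- of adjacent columns; unlike them it is decidable.
record IsConvexPolyomino {w h} (g : Grid w h) : Set where
  field
    touchLeft   : ∃ λ y → (+ 0 , y) ∈G g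
    touchBottom : ∃ λ x → (x , + 0) ∈G g
    touchRight  : ∃ λ y → (+ w ℤ.- ℤ.1ℤ , y) ∈G g
    touchTop    : ∃ λ x → (x , + h ℤ.- ℤ.1ℤ) ∈G g
    rows        : ∀ y → Contiguous (row g y)
    columns     : ∀ x → Contiguous (column g x)
    overlaps    : ColumnsOverlap g

isConvexPolyomino? : ∀ {w h} (g : Grid w h) → Dec (IsConvexPolyomino g)
isConvexPolyomino? {w} {h} g = map′
  (λ (l , b , r , t , rs , cs , o) → record { touchLeft = l ; touchBottom = b ; touchRight = r ; touchTop = t
                                            ; rows = rs ; columns = cs ; overlaps = o })
  (λ c → let open IsConvexPolyomino c in touchLeft , touchBottom , touchRight , touchTop , rows , columns , overlaps)
  (columnOccupied? g (+ 0) ×-dec rowOccupied? g (+ 0) ×-dec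
   columnOccupied? g (+ w ℤ.- ℤ.1ℤ) ×-dec rowOccupied? g (+ h ℤ.- ℤ.1ℤ) ×-dec
   ∀? h (λ y h≤y → contiguous-empty λ x → column-aboveTop g h≤y)
        (λ y → contiguous? w (row g y) λ x → column-pastRight g) ×-dec
   ∀? w (λ x w≤x → contiguous-empty λ y → column-pastRight g w≤x)
        (λ x → contiguous? h (column g x) λ y → column-aboveTop g) ×-dec
   columnsOverlap? g)

toPolyomino : ∀ {w h} (g : Grid w h) → Irr.Irrelevant (IsConvexPolyomino g) → ConvexPolyomino
toPolyomino {w} {h} g Irr.[ c ] = record
  { w = w ; h = h ; grid = g
  ; touchLeft = C.touchLeft c ; touchBottom = C.touchBottom c ; touchRight = C.touchRight c ; touchTop = C.touchTop c
  ; connected = columnsOverlap⇒connected g (C.columns c) (C.touchLeft c) (C.overlaps c)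
  ; rowConvex = contiguous⇒rowConvex g (C.rows c)
  ; colConvex = contiguous⇒colConvex g (C.columns c) }
  where module C = IsConvexPolyomino

isConvexPolyomino : (ν : ConvexPolyomino) → Irr.Irrelevant (IsConvexPolyomino (ConvexPolyomino.grid ν))
isConvexPolyomino record { grid = g ; touchLeft = left ; touchBottom = bottom ; touchRight = right ; touchTop = top
                         ; connected = conn ; rowConvex = rc ; colConvex = cc } =
  Irr.[ record { touchLeft = left ; touchBottom = bottom ; touchRight = right ; touchTop = top
               ; rows = rowConvex⇒contiguous g rc ; columns = colConvex⇒contiguous g cc
               ; overlaps = connected⇒columnsOverlap g conn left right } ]

Finite : Set → Set
Finite A = ∃ λ k → Fin k ↔ A

finite-↔ : ∀ {A B : Set} → A ↔ B → Finite A → Finite B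
finite-↔ A↔B (k , Fin↔A) = k , ↔-trans Fin↔A A↔B

finite-prop : ∀ {A : Set} → Dec A → Irrelevant A → Finite A
finite-prop (yes a) irr = 1 , mk↔ₛ′ (λ _ → a) (λ _ → zero) (irr a) λ { zero → refl }
finite-prop (no ¬a) _   = 0 , mk↔ₛ′ (λ ()) (⊥-elim ∘ ¬a) (⊥-elim ∘ ¬a) (λ ())

finite-⊎ : ∀ {A B : Set} → Finite A → Finite B → Finite (A ⊎ B)
finite-⊎ (k , Fin↔A) (m , Fin↔B) = k + m , ↔-trans +↔⊎ (Fin↔A ⊎-↔ Fin↔B)

finite-Σ-Fin : ∀ k {B : Fin k → Set} → (∀ i → Finite (B i)) → Finite (Σ (Fin k) B)
finite-Σ-Fin zero    _   = 0 , mk↔ₛ′ (λ ()) (λ { (() , _) }) (λ { (() , _) }) (λ ())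
finite-Σ-Fin (suc k) {B} fin = finite-↔ split (finite-⊎ (fin zero) (finite-Σ-Fin k (fin ∘ suc)))
  where
  split : (B zero ⊎ Σ (Fin k) (B ∘ suc)) ↔ Σ (Fin (suc k)) B
  split = mk↔ₛ′ (λ { (inj₁ b) → zero , b ; (inj₂ (i , b)) → suc i , b })
                (λ { (zero , b) → inj₁ b ; (suc i , b) → inj₂ (i , b) })
                (λ { (zero , _) → refl ; (suc _ , _) → refl })
                (λ { (inj₁ _) → refl ; (inj₂ _) → refl })

finite-Σ : ∀ {A : Set} {B : A → Set} → Finite A → (∀ a → Finite (B a)) → Finite (Σ A B)
finite-Σ (k , Fin↔A) fin = finite-↔ (Σ-↔ Fin↔A ↔-refl) (finite-Σ-Fin k (fin ∘ Inverse.to Fin↔A))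

finite-Bool : Finite Bool
finite-Bool = 2 , 2↔Bool

finite-Vec : ∀ {A : Set} n → Finite A → Finite (Vec A n)
finite-Vec zero    _   = finite-prop (yes []) λ { [] [] → refl }
finite-Vec {A} (suc n) fin = finite-↔ cons (finite-Σ fin λ _ → finite-Vec n fin)
  where
  cons : (A × Vec A n) ↔ Vec A (suc n)
  cons = mk↔ₛ′ (λ { (x , xs) → x ∷ xs }) (λ { (x ∷ xs) → x , xs }) (λ { (_ ∷ _) → refl }) (λ { (_ , _) → refl })

finite-< : ∀ N → Finite (Σ ℕ (_< N))
finite-< N = N , mk↔ₛ′ (λ i → toℕ i , toℕ<n i) (λ (_ , m<N) → fromℕ< m<N)
  (λ (_ , m<N) → pair (toℕ-fromℕ< m<N)) (λ i → fromℕ<-toℕ i (toℕ<n i))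
  where
  pair : ∀ {m n} → m ≡ n → {p : m < N} {q : n < N} → (m , p) ≡ (n , q)
  pair refl = cong (_ ,_) (<-irrelevant _ _)

finite-bounded : ∀ N {B : ℕ → Set} → (∀ k → k < N → Finite (B k)) → Finite (Σ ℕ λ k → k < N × B k)
finite-bounded N fin = finite-↔ Σ-assoc (finite-Σ (finite-< N) λ (k , k<N) → fin k k<N)

Σ-↔-props : ∀ {A : Set} {P Q : A → Set} → (∀ a → Irrelevant (P a)) → (∀ a → Irrelevant (Q a)) →
  (∀ a → P a ⇔ Q a) → Σ A P ↔ Σ A Q
Σ-↔-props irrP irrQ P⇔Q = Σ-↔ ↔-refl λ {a} → let open Equivalence (P⇔Q a) in
  mk↔ₛ′ to from (λ _ → irrQ a _ _) (λ _ → irrP a _ _)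

irrelevant? : ∀ {A : Set} → Dec A → Dec (Irr.Irrelevant A)
irrelevant? (yes a) = yes Irr.[ a ]
irrelevant? (no ¬a) = no λ { Irr.[ a ] → ⊥-elim-irr (¬a a) }

finite-polyominoes : ∀ {P : ConvexPolyomino → Set} N → (∀ ν → Finite (P ν)) →
  (∀ ν → P ν → ConvexPolyomino.w ν < N × ConvexPolyomino.h ν < N) → Finite (Σ ConvexPolyomino P)
finite-polyominoes {P} N finite-P bounded = finite-↔ search↔
  (finite-bounded N λ w _ → finite-bounded N λ h _ →
   finite-Σ (finite-Vec h (finite-Vec w finite-Bool)) λ g →
   finite-Σ (finite-prop (irrelevant? (isConvexPolyomino? g)) (λ _ _ → refl)) λ _ → finite-P _)
  where
  Search : Set
  Search = Σ ℕ λ w → w < N × Σ ℕ λ h → h < N × Σ (Grid w h) λ g →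
           Σ (Irr.Irrelevant (IsConvexPolyomino g)) λ c → P (toPolyomino g c)
  search↔ : Search ↔ Σ ConvexPolyomino P
  search↔ = mk↔ₛ′
    (λ (_ , _ , _ , _ , g , c , p) → toPolyomino g c , p)
    (λ (ν , p) → let open ConvexPolyomino ν in
                 w , proj₁ (bounded ν p) , h , proj₂ (bounded ν p) , grid , isConvexPolyomino ν , p)
    (λ _ → refl)
    (λ (w , _ , h , _ , g , c , p) → cong₂ (λ w<N h<N → w , w<N , h , h<N , g , c , p)
                                           (<-irrelevant _ _) (<-irrelevant _ _))

≡⇔≡∸ : ∀ {a b n k} → a ≡ b + k → k ≤ n → (a ≡ n) ⇔ (b ≡ n ∸ k)
≡⇔≡∸ {a} {b} {n} {k} a≡b+k k≤n = mk⇔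
  (λ a≡n → trans (sym (m+n∸n≡m b k)) (cong (_∸ k) (trans (sym a≡b+k) a≡n)))
  (λ b≡n∸k → trans a≡b+k (trans (cong (_+ k) b≡n∸k) (m∸n+n≡m k≤n)))

d₂+d₃≡d₃+d₄+4 : ∀ ν → d 2 ν + d 3 ν ≡ d 3 ν + d 4 ν + 4
d₂+d₃≡d₃+d₄+4 ν = begin
  d 2 ν + d 3 ν        ≡⟨ cong (_+ d 3 ν) (d₂≡d₄+4 ν) ⟩
  d 4 ν + 4 + d 3 ν    ≡⟨ +-comm (d 4 ν + 4) (d 3 ν) ⟩
  d 3 ν + (d 4 ν + 4)  ≡⟨ +-assoc (d 3 ν) (d 4 ν) 4 ⟨
  d 3 ν + d 4 ν + 4    ∎
  where open ≡-Reasoning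

mainTheorem11 : (n : ℕ) → 4 ≤ n →
    ∃ λ k → (Fin k ↔ Σ ConvexPolyomino (λ ν → d 2 ν + d 3 ν ≡ n))
          × (Fin k ↔ Σ ConvexPolyomino (λ ν → d 3 ν + d 4 ν ≡ n ∸ 4))
mainTheorem11 n 4≤n = k , Fin↔S₁ , ↔-trans Fin↔S₁ S₁↔S₂
  where
  S₁-finite : Finite (Σ ConvexPolyomino λ ν → d 2 ν + d 3 ν ≡ n)
  S₁-finite = finite-polyominoes (suc (n + n))
    (λ ν → finite-prop (d 2 ν + d 3 ν ≟ n) ≡-irrelevant)
    (λ ν d₂+d₃≡n → let w≤ , h≤ = dimensions≤ ν d₂+d₃≡n in s≤s w≤ , s≤s h≤)
  k = proj₁ S₁-finite
  Fin↔S₁ = proj₂ S₁-finite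
  S₁↔S₂ = Σ-↔-props (λ _ → ≡-irrelevant) (λ _ → ≡-irrelevant)
            λ ν → ≡⇔≡∸ (d₂+d₃≡d₃+d₄+4 ν) 4≤n
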